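{- Let $\mathcal T$ be a basic theory and $\zeta\Rightarrow_r\eta$ a graded implication. If there is a forest proof of $\zeta\Rightarrow_r\eta$ from $\mathcal T$, then there is a forest proof of $\zeta\Rightarrow_r\eta$ from $\mathcal T$ in which every inconsistent clause is non-terminal and has $\divideontimes$ as its only child.
   Context: Boolean formulas are built from countably many variables and $\bot,\top$ via $\wedge,\vee,\neg$; $\alpha,\beta$ are Boolean equivalent if $\alpha\to\beta$ and $\beta\to\alpha$ are classical tautologies. A graded implication is $\alpha\Rightarrow_d\beta$, $d\in\mathbb R^+=[0,\infty)$. A literal is $\phi$ or $\neg\phi$ for a variable $\phi$; a clause is a finite set of literals, inconsistent if it contains some $\phi$ and $\neg\phi$, consistent otherwise; a clause set is a finite set of clauses. For a clause set $B$, $f(B)=\bigvee_{L\in B}\bigwedge L$ (empty conjunction $=\top$, empty disjunction $=\bot$); $B$ is a clause set for $\alpha$ if $f(B)$ is Boolean equivalent to $\alpha$. A basic implication is $\lambda_1\wedge\dots\wedge\lambda_n\Rightarrow_d\bigvee_{i=1}^l\bigwedge_{j=1}^{k_i}\mu_{ij}$ with $n\ge1$, $l\ge0$, $k_i\ge1$, where $\{\lambda_1,\dots,\lambda_n\}$ and all $\{\mu_{i1},\dots,\mu_{ik_i}\}$ are consistent clauses; a basic theory is a set of basic implications. A proof forest is a finite directed forest (each component a rooted tree, edges directed from father to child) with a weight in $\mathbb R^+$ on each edge, each node labelled by a clause or by the symbol $\divideontimes$ (nodes identified with labels). A branch is a maximal root-to-leaf path; its length is $0$ if it contains $\divideontimes$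 and otherwise the sum of its edge weights; the length of the forest is the maximum length of its branches. A forest proof of $\zeta\Rightarrow_r\eta$ from a basic theory $\mathcal T$ is a proof forest such that: (T1) there is a clause set $B_\zeta$ for $\zeta$ such that each clause of $B_\zeta$ has a root that is a subset of it; (T2) there is a clause set $B_\eta$ for $\eta$ such that every terminal clause includes some clause of $B_\eta$; (T3) the length of the forest is at most $r$; (T4) for every non-terminal clause $L$, all edges from $L$ have the same weight $c$, and one of: (A) $c=0$ and $\mathcal T$ contains a basic implication $\lambda_1\wedge\dots\wedge\lambda_n\Rightarrow_0\bigvee_{i=1}^l\bigwedge_j\mu_{ij}$ with $\{\lambda_1,\dots,\lambda_n\}\subseteq L$ such that for each $i$ some child of $L$ is a clause $L'\subseteq\{\mu_{i1},\dots,\mu_{ik_i}\}\cup L$; (B) $c>0$ and $\mathcal T$ contains a basic implication $\lambda_1\wedge\dots\wedge\lambda_n\Rightarrow_c\bigvee_{i=1}^l\bigwedge_j\mu_{ij}$ with $\{\lambda_1,\dots,\lambda_n\}\subseteq L$ such that for each $i$ some child of $L$ is a clause $L'\subseteq\{\mu_{i1},\dots,\mu_{ik_i}\}$; (C) $c=0$, $L$ is inconsistent and $\divideontimes$ is the only child of $L$; (D) $c=0$ and for some variable $\phi$, $L$ has exactly two children, one consisting of $\phi$ together with a subset of $L$, the other of $\neg\phi$ together with a subset of $L$. -}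

module Defs where

open import Data.Nat using (ℕ)
open import Data.Bool using (Bool; true; false; _∧_; _∨_; not)
open import Data.List using (List; []; _∷_; foldr; map; _++_)
open import Data.List.Membership.Propositional using (_∈_)
open import Data.List.Relation.Binary.Subset.Propositional using (_⊆_)
open import Data.List.Relation.Unary.All using (All)
open import Data.List.Relation.Unary.Any using (Any)
open import Data.Product using (Σ; ∃; _×_; _,_; proj₁; proj₂)
open import Data.Sum using (_⊎_)
open import Relation.Binary.PropositionalEquality using (_≡_; _≢_)
open import Relation.Binary.Structures using (IsTotalOrder)
open import Relation.Nullary using (¬_)
open import Data.Unit using (⊤)

data Formula : Set where
  fvar : ℕ → Formula
  fbot ftop : Formula
  _∧f_ _∨f_ : Formula → Formula → Formula
  ¬f_ : Formula → Formula

eval : (ℕ → Bool) → Formula → Bool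
eval v (fvar x) = v x
eval v fbot = false
eval v ftop = true
eval v (a ∧f b) = eval v a ∧ eval v b
eval v (a ∨f b) = eval v a ∨ eval v b
eval v (¬f a) = not (eval v a)

Tautology : Formula → Set
Tautology φ = ∀ (v : ℕ → Bool) → eval v φ ≡ true

_⇒f_ : Formula → Formula → Formula
a ⇒f b = (¬f a) ∨f b

BoolEquiv : Formula → Formula → Set
BoolEquiv a b = Tautology (a ⇒f b) × Tautology (b ⇒f a)

-- Literals, clauses (finite sets of literals, represented by lists;
-- all notions below only depend on membership), clause sets

data Literal : Set where
  pos neg : ℕ → Literal

Clause : Set
Clause = List Literal

Inconsistent : Clause → Set
Inconsistent L = ∃ λ (φ : ℕ) → (pos φ ∈ L) × (neg φ ∈ L)

Consistent : Clause → Set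
Consistent L = ¬ Inconsistent L

ClauseSet : Set
ClauseSet = List Clause

litF : Literal → Formula
litF (pos x) = fvar x
litF (neg x) = ¬f (fvar x)

conjF : Clause → Formula
conjF = foldr (λ l acc → litF l ∧f acc) ftop

fB : ClauseSet → Formula
fB = foldr (λ L acc → conjF L ∨f acc) fbot

IsClauseSetFor : ClauseSet → Formula → Set
IsClauseSetFor B α = BoolEquiv (fB B) α

-- The paper uses ℝ⁺ = [0,∞), which is not available in the
-- Agda standard library.  We abstract over any totally ordered
-- commutative monoid whose unit is least (ℝ⁺ with +, ≤ is an instance).

record Weights : Set₁ where
  field
    Carrier : Set
    0#      : Carrier
    _+_     : Carrier → Carrier → Carrier
    _≤_     : Carrier → Carrier → Set
    isTotalOrder : IsTotalOrder _≡_ _≤_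
    +-assoc : ∀ x y z → (x + y) + z ≡ x + (y + z)
    +-comm  : ∀ x y → x + y ≡ y + x
    +-identityˡ : ∀ x → 0# + x ≡ x
    +-monoˡ-≤ : ∀ {x y} z → x ≤ y → (x + z) ≤ (y + z)
    0-least : ∀ x → 0# ≤ x

  _<_ : Carrier → Carrier → Set
  x < y = (x ≤ y) × (x ≢ y)

module WithWeights (W : Weights) where
  open Weights W

  -- λ₁ ∧ … ∧ λₙ ⇒_d ⋁ᵢ ⋀ⱼ μᵢⱼ
  record BasicImp : Set where
    constructor mkImp
    field
      lhs : Clause
      deg : Carrier
      rhs : List Clause

  IsBasic : BasicImp → Set
  IsBasic i = (BasicImp.lhs i ≢ []) × Consistent (BasicImp.lhs i)
              × All (λ μ → (μ ≢ []) × Consistent μ) (BasicImp.rhs i)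

  -- a (possibly infinite) set of basic implications
  record BasicTheory : Set₁ where
    field
      _∋_   : BasicImp → Set
      basic : ∀ i → _∋_ i → IsBasic i

  data Label : Set where
    clause : Clause → Label
    star   : Label

  -- a rooted tree; children are listed together with the weight of the
  -- edge leading to them
  data Tree : Set where
    node : Label → List (Carrier × Tree) → Tree

  label : Tree → Label
  label (node l _) = l

  children : Tree → List (Carrier × Tree)
  children (node _ cs) = cs

  childLabels : List (Carrier × Tree) → List Label
  childLabels = map (λ p → label (proj₂ p))

  Forest : Set
  Forest = List Tree

  data _∈ᵗ_ : Tree → Tree → Set where
    here  : ∀ {t} → t ∈ᵗ t
    child : ∀ {t l cs w s} → (w , s) ∈ cs → t ∈ᵗ s → t ∈ᵗ node l cs

  NodeOf : Forest → Tree → Set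
  NodeOf F t = ∃ λ s → (s ∈ F) × (t ∈ᵗ s)

  data Branch : Tree → Set where
    end  : ∀ {l} → Branch (node l [])
    down : ∀ {l cs w t} → (w , t) ∈ cs → Branch t → Branch (node l cs)

  branchLabels : ∀ {t} → Branch t → List Label
  branchLabels (end {l}) = l ∷ []
  branchLabels (down {l} _ b) = l ∷ branchLabels b

  branchWeights : ∀ {t} → Branch t → List Carrier
  branchWeights end = []
  branchWeights (down {w = w} _ b) = w ∷ branchWeights b

  isStar : Label → Bool
  isStar (clause _) = false
  isStar star = true

  anyB : List Bool → Bool
  anyB = foldr _∨_ false

  sumW : List Carrier → Carrier
  sumW = foldr _+_ 0#

  branchLength : ∀ {t} → Branch t → Carrier
  branchLength b with anyB (map isStar (branchLabels b))
  ... | true  = 0#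
  ... | false = sumW (branchWeights b)

  LengthAtMost : Forest → Carrier → Set
  LengthAtMost F r = ∀ t → t ∈ F → (b : Branch t) → branchLength b ≤ r

  -- Rule (T4) at a non-terminal clause L with children cs, edge weight c

  RuleA : BasicTheory → Clause → List (Carrier × Tree) → Carrier → Set
  RuleA T L cs c = (c ≡ 0#) × Σ BasicImp λ i → (T BasicTheory.∋ i)
    × (BasicImp.deg i ≡ 0#) × (BasicImp.lhs i ⊆ L)
    × (∀ μ → μ ∈ BasicImp.rhs i →
         Any (λ p → ∃ λ L' → (label (proj₂ p) ≡ clause L') × (L' ⊆ μ ++ L)) cs)

  RuleB : BasicTheory → Clause → List (Carrier × Tree) → Carrier → Set
  RuleB T L cs c = (0# < c) × Σ BasicImp λ i → (T BasicTheory.∋ i)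
    × (BasicImp.deg i ≡ c) × (BasicImp.lhs i ⊆ L)
    × (∀ μ → μ ∈ BasicImp.rhs i →
         Any (λ p → ∃ λ L' → (label (proj₂ p) ≡ clause L') × (L' ⊆ μ)) cs)

  RuleC : Clause → List (Carrier × Tree) → Carrier → Set
  RuleC L cs c = (c ≡ 0#) × Inconsistent L × (childLabels cs ≡ star ∷ [])

  LitPlusSubset : Literal → Clause → Clause → Set
  LitPlusSubset x L L₁ = (x ∈ L₁) × (L₁ ⊆ x ∷ L)

  RuleD : Clause → List (Carrier × Tree) → Carrier → Set
  RuleD L cs c = (c ≡ 0#) × ∃ λ (φ : ℕ) → ∃ λ L₁ → ∃ λ L₂ →
      (childLabels cs ≡ clause L₁ ∷ clause L₂ ∷ [])
    × ((LitPlusSubset (pos φ) L L₁ × LitPlusSubset (neg φ) L L₂)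
       ⊎ (LitPlusSubset (neg φ) L L₁ × LitPlusSubset (pos φ) L L₂))

  NodeOK : BasicTheory → Tree → Set
  NodeOK T (node star cs) = ⊤
  NodeOK T (node (clause L) []) = ⊤
  NodeOK T (node (clause L) cs@(_ ∷ _)) = ∃ λ c → All (λ p → proj₁ p ≡ c) cs
    × (RuleA T L cs c ⊎ RuleB T L cs c ⊎ RuleC L cs c ⊎ RuleD L cs c)

  record ForestProof (T : BasicTheory) (ζ : Formula) (r : Carrier) (η : Formula)
                     (F : Forest) : Set where
    field
      T1 : ∃ λ Bζ → IsClauseSetFor Bζ ζ ×
             (∀ K → K ∈ Bζ → ∃ λ t → (t ∈ F) × ∃ λ R → (label t ≡ clause R) × (R ⊆ K))
      T2 : ∃ λ Bη → IsClauseSetFor Bη η ×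
             (∀ t → NodeOf F t → ∀ L → t ≡ node (clause L) [] →
                Any (λ K → K ⊆ L) Bη)
      T3 : LengthAtMost F r
      T4 : ∀ t → NodeOf F t → NodeOK T t

  InconsistentHandled : Forest → Set
  InconsistentHandled F = ∀ t → NodeOf F t → ∀ L → label t ≡ clause L →
    Inconsistent L → childLabels (children t) ≡ star ∷ []

-- Prune every tree of the forest top-down: at a node whose
-- label is an inconsistent clause L, discard the whole subtree below L and
-- hang a single ⊛-leaf under L with an edge of weight 0 (rule (C));
-- elsewhere keep the label and the edge weights and prune the children.
-- Inconsistency of a clause is decidable, so pruning is a function.

module Submission where

open import Defs
open import Data.Bool using (true; false; if_then_else_)
open import Data.Empty using (⊥-elim)
open import Data.List using (List; []; _∷_; map)
open import Data.List.Membership.Propositional using (_∈_; find; lose)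
open import Data.List.Membership.Propositional.Properties using (∈-map⁺; ∈-map⁻)
open import Data.List.Membership.DecPropositional using () renaming (_∈?_ to member?)
open import Data.List.Relation.Binary.Pointwise as Pointwise
  using (Pointwise; []; _∷_; Any-resp-Pointwise; All-resp-Pointwise; Pointwise-≡⇒≡)
open import Data.List.Relation.Binary.Subset.Propositional using (_⊆_)
open import Data.List.Relation.Unary.All using ([]; _∷_)
open import Data.List.Relation.Unary.Any using (Any; here; there; any?)
open import Data.Nat using () renaming (_≟_ to _≟ℕ_)
open import Data.Product using (Σ; ∃; _×_; _,_; proj₁; proj₂)
open import Data.Sum using (_⊎_; inj₁; inj₂)
open import Data.Unit using (tt)
open import Relation.Binary.Definitions using (DecidableEquality; _Respects_)
open import Relation.Binary.PropositionalEquality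
  using (_≡_; refl; sym; trans; cong; cong₂; subst; module ≡-Reasoning)
open import Relation.Nullary using (Dec; yes; no)
open import Relation.Nullary.Decidable using (map′)

_≟ₗ_ : DecidableEquality Literal
pos x ≟ₗ pos y = map′ (cong pos) (λ { refl → refl }) (x ≟ℕ y)
neg x ≟ₗ neg y = map′ (cong neg) (λ { refl → refl }) (x ≟ℕ y)
pos x ≟ₗ neg y = no λ ()
neg x ≟ₗ pos y = no λ ()

-- A literal of a clause L clashes with L if it is positive and its
-- complement also occurs in L; L is inconsistent iff one of its literals
-- clashes with it.
Clash : Clause → Literal → Set
Clash L l = ∃ λ φ → (l ≡ pos φ) × (neg φ ∈ L)

clash? : ∀ L l → Dec (Clash L l)
clash? L (pos φ) = map′ (λ n → φ , refl , n) (λ { (_ , refl , n) → n })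
                        (member? _≟ₗ_ (neg φ) L)
clash? L (neg φ) = no λ { (_ , () , _) }

inconsistent? : ∀ L → Dec (Inconsistent L)
inconsistent? L = map′ fromClash toClash (any? (clash? L) L)
  where
  fromClash : Any (Clash L) L → Inconsistent L
  fromClash a with find a
  ... | _ , l∈L , φ , refl , n = φ , l∈L , n

  toClash : Inconsistent L → Any (Clash L) L
  toClash (φ , p , n) = lose p (φ , refl , n)

module Pruning (W : Weights) where
  open Weights W
  open WithWeights W

  starLeaf : Tree
  starLeaf = node star []

  mutual
    prune : Tree → Tree
    prune (node star cs)       = node star (pruneAll cs)
    prune (node (clause L) cs) = node (clause L) (pruneChildren L (inconsistent? L) cs)

    pruneChildren : (L : Clause) → Dec (Inconsistent L) →
                    List (Carrier × Tree) → List (Carrier × Tree)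
    pruneChildren L (yes _) cs = (0# , starLeaf) ∷ []
    pruneChildren L (no _)  cs = pruneAll cs

    pruneAll : List (Carrier × Tree) → List (Carrier × Tree)
    pruneAll []             = []
    pruneAll ((w , t) ∷ cs) = (w , prune t) ∷ pruneAll cs

  label-prune : ∀ t → label (prune t) ≡ label t
  label-prune (node star cs)       = refl
  label-prune (node (clause L) cs) = refl

  -- Rule (T4) at a clause depends only on the weights and labels of its
  -- children; since pruning keeps these, it keeps (T4) at consistent clauses.

  record SameEdge (p q : Carrier × Tree) : Set where
    constructor sameEdge
    field
      same-weight : proj₁ p ≡ proj₁ q
      same-label  : label (proj₂ p) ≡ label (proj₂ q)
  open SameEdge

  SameShape : List (Carrier × Tree) → List (Carrier × Tree) → Set
  SameShape = Pointwise SameEdge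

  sameShape-pruneAll : ∀ cs → SameShape cs (pruneAll cs)
  sameShape-pruneAll []             = []
  sameShape-pruneAll ((w , t) ∷ cs) =
    sameEdge refl (sym (label-prune t)) ∷ sameShape-pruneAll cs

  childLabels-shape : ∀ {cs cs'} → SameShape cs cs' → childLabels cs ≡ childLabels cs'
  childLabels-shape sh =
    Pointwise-≡⇒≡ (Pointwise.map⁺ _ _ (Pointwise.map same-label sh))

  weight-resp : ∀ c → (λ (p : Carrier × Tree) → proj₁ p ≡ c) Respects SameEdge
  weight-resp c e = trans (sym (same-weight e))

  label-resp : (P : Label → Set) → (λ (p : Carrier × Tree) → P (label (proj₂ p))) Respects SameEdge
  label-resp P e = subst P (same-label e)

  module _ (T : BasicTheory) where

    nodeOK-shape : ∀ {L cs cs'} → SameShape cs cs' →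
                   NodeOK T (node (clause L) cs) → NodeOK T (node (clause L) cs')
    nodeOK-shape []  _ = tt
    nodeOK-shape {L} {cs@(_ ∷ _)} {cs'@(_ ∷ _)} sh (c , weights , rule) =
      c , All-resp-Pointwise (weight-resp c) sh weights , transport rule
      where
      covered-resp : ∀ {X} →
        Any (λ p → ∃ λ L' → (label (proj₂ p) ≡ clause L') × (L' ⊆ X)) cs →
        Any (λ p → ∃ λ L' → (label (proj₂ p) ≡ clause L') × (L' ⊆ X)) cs'
      covered-resp {X} = Any-resp-Pointwise (label-resp (λ l → ∃ λ L' → (l ≡ clause L') × (L' ⊆ X))) sh

      transport : RuleA T L cs c ⊎ RuleB T L cs c ⊎ RuleC L cs c ⊎ RuleD L cs c →
                  RuleA T L cs' c ⊎ RuleB T L cs' c ⊎ RuleC L cs' c ⊎ RuleD L cs' c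
      transport (inj₁ (e , i , i∈T , d , lhs⊆ , covers)) =
        inj₁ (e , i , i∈T , d , lhs⊆ , λ μ m → covered-resp (covers μ m))
      transport (inj₂ (inj₁ (e , i , i∈T , d , lhs⊆ , covers))) =
        inj₂ (inj₁ (e , i , i∈T , d , lhs⊆ , λ μ m → covered-resp (covers μ m)))
      transport (inj₂ (inj₂ (inj₁ (e , inc , labels)))) =
        inj₂ (inj₂ (inj₁ (e , inc , trans (sym (childLabels-shape sh)) labels)))
      transport (inj₂ (inj₂ (inj₂ (e , φ , L₁ , L₂ , labels , split)))) =
        inj₂ (inj₂ (inj₂ (e , φ , L₁ , L₂ , trans (sym (childLabels-shape sh)) labels , split)))

    -- Every node that satisfies (T4) still does after pruning: an
    -- inconsistent clause now uses rule (C); any other node keeps the shape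
    -- of its children.
    nodeOK-prune : ∀ t → NodeOK T t → NodeOK T (prune t)
    nodeOK-prune (node star cs)       _  = tt
    nodeOK-prune (node (clause L) cs) ok = nodeOK-pruneChildren (inconsistent? L) ok
      where
      nodeOK-pruneChildren : ∀ d → NodeOK T (node (clause L) cs) →
                             NodeOK T (node (clause L) (pruneChildren L d cs))
      nodeOK-pruneChildren (yes inc) _  = 0# , refl ∷ [] , inj₂ (inj₂ (inj₁ (refl , inc , refl)))
      nodeOK-pruneChildren (no _)    ok = nodeOK-shape (sameShape-pruneAll cs) ok

  handled-prune : ∀ t {L} → label (prune t) ≡ clause L → Inconsistent L →
                  childLabels (children (prune t)) ≡ star ∷ []
  handled-prune (node (clause L) cs) refl inc = handled (inconsistent? L)
    where
    handled : ∀ d → childLabels (pruneChildren L d cs) ≡ star ∷ []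
    handled (yes _)  = refl
    handled (no con) = ⊥-elim (con inc)

  leaf-prune : ∀ t {L} → prune t ≡ node (clause L) [] → t ≡ node (clause L) []
  leaf-prune (node (clause L) cs) e =
    cong₂ node (cong label e) (noChildren (inconsistent? L) cs (cong children e))
    where
    -- the ⊛-leaf and a non-empty list of pruned children are not empty
    noChildren : ∀ d ds → pruneChildren L d ds ≡ [] → ds ≡ []
    noChildren (no _) [] _ = refl

  ∈-pruneAll : ∀ cs {w s} → (w , s) ∈ pruneAll cs → ∃ λ s₀ → ((w , s₀) ∈ cs) × (s ≡ prune s₀)
  ∈-pruneAll ((w , t) ∷ cs) (here refl) = t , here refl , refl
  ∈-pruneAll (_ ∷ cs)       (there m) with ∈-pruneAll cs m
  ... | s₀ , m₀ , e = s₀ , there m₀ , e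

  ∈-pruneChildren : ∀ L d cs {w s} → (w , s) ∈ pruneChildren L d cs →
                    (s ≡ starLeaf) ⊎ (∃ λ s₀ → ((w , s₀) ∈ cs) × (s ≡ prune s₀))
  ∈-pruneChildren L (yes _) cs (here refl) = inj₁ refl
  ∈-pruneChildren L (no _)  cs m           = inj₂ (∈-pruneAll cs m)

  nodes-starLeaf : ∀ {t} → t ∈ᵗ starLeaf → t ≡ starLeaf
  nodes-starLeaf here = refl

  PrunedNode : Tree → Tree → Set
  PrunedNode s t' = ∃ λ t → (t ∈ᵗ s) × ((t' ≡ prune t) ⊎ (t' ≡ starLeaf))

  inChild : ∀ {l cs w s t'} → (w , s) ∈ cs → PrunedNode s t' → PrunedNode (node l cs) t'
  inChild m (t , t∈s , e) = t , child m t∈s , e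

  node-prune : ∀ s {t'} → t' ∈ᵗ prune s → PrunedNode s t'
  node-prune (node star cs) (child m q) with ∈-pruneAll cs m
  ... | s₀ , m₀ , refl = inChild m₀ (node-prune s₀ q)
  node-prune (node (clause L) cs) (child m q) with ∈-pruneChildren L (inconsistent? L) cs m
  ... | inj₁ refl            = node (clause L) cs , here , inj₂ (nodes-starLeaf q)
  ... | inj₂ (s₀ , m₀ , refl) = inChild m₀ (node-prune s₀ q)
  node-prune s here = s , here , inj₁ refl

  HasStar : ∀ {t} → Branch t → Set
  HasStar b = anyB (map isStar (branchLabels b)) ≡ true

  SameBranch : ∀ {s t} → Branch s → Branch t → Set
  SameBranch b b' = (branchLabels b ≡ branchLabels b') × (branchWeights b ≡ branchWeights b')

  star-root : ∀ {cs} (b : Branch (node star cs)) → HasStar b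
  star-root end        = refl
  star-root (down _ _) = refl

  branch-prune : ∀ s (b' : Branch (prune s)) → HasStar b' ⊎ (∃ λ (b : Branch s) → SameBranch b b')
  branch-prune (node star cs) b' = inj₁ (star-root b')
  branch-prune (node (clause L) cs) b' with inconsistent? L
  branch-prune (node (clause L) cs) (down (here refl) b'') | yes _ = inj₁ (star-root b'')
  branch-prune (node (clause L) []) end | no _ = inj₂ (end , refl , refl)
  branch-prune (node (clause L) (_ ∷ cs)) (down m b'') | no _ with ∈-pruneAll (_ ∷ cs) m
  ... | s₀ , m₀ , refl with branch-prune s₀ b''
  ... | inj₁ star∈b'' = inj₁ star∈b''
  ... | inj₂ (b , same-labels , same-weights) =
    inj₂ (down m₀ b , cong (clause L ∷_) same-labels , cong (_ ∷_) same-weights)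

  lengthOf : List Label → List Carrier → Carrier
  lengthOf ls ws = if anyB (map isStar ls) then 0# else sumW ws

  branchLength-lengthOf : ∀ {t} (b : Branch t) →
                          branchLength b ≡ lengthOf (branchLabels b) (branchWeights b)
  branchLength-lengthOf b with anyB (map isStar (branchLabels b))
  ... | true  = refl
  ... | false = refl

  length-star : ∀ {t} (b : Branch t) → HasStar b → branchLength b ≡ 0#
  length-star b star∈b with anyB (map isStar (branchLabels b))
  length-star b refl | true = refl

  same-length : ∀ {s t} {b : Branch s} {b' : Branch t} → SameBranch b b' →
                branchLength b ≡ branchLength b'
  same-length {b = b} {b'} (same-labels , same-weights) = begin
    branchLength b                                  ≡⟨ branchLength-lengthOf b ⟩
    lengthOf (branchLabels b) (branchWeights b)     ≡⟨ cong₂ lengthOf same-labels same-weights ⟩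
    lengthOf (branchLabels b') (branchWeights b')   ≡⟨ branchLength-lengthOf b' ⟨
    branchLength b'                                 ∎
    where open ≡-Reasoning

  length-prune : ∀ {r} s → (∀ (b : Branch s) → branchLength b ≤ r) →
                 ∀ (b' : Branch (prune s)) → branchLength b' ≤ r
  length-prune {r} s bounded b' with branch-prune s b'
  ... | inj₁ star∈b'  = subst (_≤ r) (sym (length-star b' star∈b')) (0-least r)
  ... | inj₂ (b , same) = subst (_≤ r) (same-length same) (bounded b)

  pruneForest : Forest → Forest
  pruneForest = map prune

  node-pruneForest : ∀ F {t'} → NodeOf (pruneForest F) t' →
                     ∃ λ t → NodeOf F t × ((t' ≡ prune t) ⊎ (t' ≡ starLeaf))
  node-pruneForest F (s' , s'∈ , t'∈s') with ∈-map⁻ prune s'∈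
  ... | s , s∈F , refl with node-prune s t'∈s'
  ... | t , t∈s , e = t , (s , s∈F , t∈s) , e

  handled-pruneForest : ∀ F → InconsistentHandled (pruneForest F)
  handled-pruneForest F t' n L e inc with node-pruneForest F n
  ... | t , _ , inj₁ refl = handled-prune t e inc
  handled-pruneForest F t' n L () inc | t , _ , inj₂ refl

  module _ {T : BasicTheory} {ζ : Formula} {r : Carrier} {η : Formula} {F : Forest}
           (proof : ForestProof T ζ r η F) where
    open ForestProof proof

    -- (T1): the roots keep their labels.
    T1-prune : ∃ λ Bζ → IsClauseSetFor Bζ ζ ×
      (∀ K → K ∈ Bζ → ∃ λ t → (t ∈ pruneForest F) × ∃ λ R → (label t ≡ clause R) × (R ⊆ K))
    T1-prune with T1
    ... | Bζ , forζ , rooted = Bζ , forζ , λ K K∈ → root (rooted K K∈)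
      where
      root : ∀ {K} → (∃ λ t → (t ∈ F) × ∃ λ R → (label t ≡ clause R) × (R ⊆ K)) →
             ∃ λ t → (t ∈ pruneForest F) × ∃ λ R → (label t ≡ clause R) × (R ⊆ K)
      root (t , t∈F , R , lab , R⊆K) = prune t , ∈-map⁺ prune t∈F , R , trans (label-prune t) lab , R⊆K

    -- (T2): terminal clauses of the pruned forest were terminal before.
    T2-prune : ∃ λ Bη → IsClauseSetFor Bη η ×
      (∀ t → NodeOf (pruneForest F) t → ∀ L → t ≡ node (clause L) [] → Any (λ K → K ⊆ L) Bη)
    T2-prune with T2
    ... | Bη , forη , covered = Bη , forη , covered'
      where
      covered' : ∀ t' → NodeOf (pruneForest F) t' → ∀ L → t' ≡ node (clause L) [] → Any (λ K → K ⊆ L) Bη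
      covered' t' n L e with node-pruneForest F n
      ... | t , nt , inj₁ refl = covered t nt L (leaf-prune t e)
      covered' t' n L () | t , nt , inj₂ refl

    -- (T3): pruned branches are no longer than original ones.
    T3-prune : LengthAtMost (pruneForest F) r
    T3-prune t' t'∈ b' with ∈-map⁻ prune t'∈
    ... | s , s∈F , refl = length-prune s (T3 s s∈F) b'

    -- (T4): kept nodes still obey a rule; fresh ⊛-leaves impose nothing.
    T4-prune : ∀ t → NodeOf (pruneForest F) t → NodeOK T t
    T4-prune t' n with node-pruneForest F n
    ... | t , nt , inj₁ refl = nodeOK-prune T t (T4 t nt)
    ... | t , nt , inj₂ refl = tt

    forestProof-prune : ForestProof T ζ r η (pruneForest F)
    forestProof-prune = record { T1 = T1-prune ; T2 = T2-prune ; T3 = T3-prune ; T4 = T4-prune }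

lemma3p8 : (W : Weights) → (T : WithWeights.BasicTheory W) →
    (ζ : Formula) → (r : Weights.Carrier W) → (η : Formula) →
    (F : WithWeights.Forest W) → WithWeights.ForestProof W T ζ r η F →
    Σ (WithWeights.Forest W) (λ F' →
      WithWeights.ForestProof W T ζ r η F' × WithWeights.InconsistentHandled W F')
lemma3p8 W T ζ r η F proof =
  pruneForest F , forestProof-prune proof , handled-pruneForest F
  where open Pruning W
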